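{- Fix $c\geq 3$. (a) For every $p\ge1$ and every $n\geq p$, $\phi_p(n)\equiv n\pmod 2$. (b) The restriction of $\phi_1$ to the innumbers for $c$ is a bijection onto the innumbers for $3$, and the restriction of $\phi_1$ to the outnumbers for $c$ is a bijection onto the outnumbers for $3$. (c) Suppose $2\leq p\leq 4$ and $h_1,\dots,h_p$ are either all innumbers for $c$ or all outnumbers for $c$. Unless $p=4$ and $h_1\equiv h_2\equiv h_3\equiv h_4\equiv 2\pmod{2c}$, we have $\phi_1(h_1)+\cdots+\phi_1(h_p)=\phi_p(h_1+\cdots+h_p)$. (d) Suppose $1\le p\le 3$, $O_n$ is a partition of $n$ into $p$ parts, and $\lfloor O_n\rfloor$ and $\lceil O_n\rceil$ are partitions of $a$ and $b$ respectively. Then $\phi_p(a)\leq\phi_p(n)\leq\phi_p(b)$.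
   Context: For $c\ge 3$ and $1\le r\le 2c$: $r'=1$ if $r=1$; $2$ if $r=2$; $3$ if $2<r<2c-1$, $r$ odd; $4$ if $2<r<2c-1$, $r$ even; $5$ if $r=2c-1$; $6$ if $r=2c$. For $p\ge1$, $n\ge p$, write $n=2cq+r+p-1$ with $q\ge0$, $1\le r\le 2c$, and set $\phi_p(n)=6q+r'+p-1$. For an integer $e\ge 2$, an innumber for $e$ is a positive integer $\equiv 1\pmod{2e}$ or $\equiv 4e+2\pmod{12e}$, and an outnumber for $e$ is a positive integer $\equiv 0\pmod{2e}$ or $\equiv 4e+1\pmod{12e}$. A partition of $n$ into $p$ parts is a tuple $(h_1,\dots,h_p)$ of positive integers summing to $n$. For a positive integer $h$, $\lfloor h\rfloor$ is the greatest innumber for $c$ that is $\le h$, and $\lceil h\rceil$ the least outnumber for $c$ that is $\ge h$. For a partition $O=(h_1,\dots,h_p)$, $\lceil O\rceil=(\lceil h_1\rceil,\dots,\lceil h_p\rceil)$ and $\lfloor O\rfloor=(\lfloor h_1\rfloor,\dots,\lfloor h_p\rfloor)$, except that when $p=3$ and $\lfloor h_1\rfloor\equiv\lfloor h_2\rfloor\equiv\lfloor h_3\rfloor\equiv 2\pmod{2c}$ one sets $\lfloor(h_1,h_2,h_3)\rfloor=(\lfloor h_1\rfloor-1,\lfloor h_2\rfloor-1,\lfloor h_3\rfloor)$. -}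

module Defs where

open import Data.Nat using (ℕ; zero; suc; _+_; _*_; _∸_; _≤_; _<_)
open import Data.Nat.DivMod using (_/_; _%_)
open import Data.Nat.Properties using (_≟_)
open import Data.Bool using (Bool; true; false; if_then_else_; _∧_)
open import Relation.Nullary using (does; ¬_)
open import Relation.Binary.PropositionalEquality using (_≡_)
open import Data.Product using (_×_; ∃-syntax; _,_)
open import Data.Sum using (_⊎_)
open import Data.Vec using (Vec; []; _∷_; sum; map)
open import Data.Vec.Relation.Unary.All using (All)
open import Data.Vec.Relation.Binary.Pointwise.Inductive using (Pointwise)

_mod_ : ℕ → ℕ → ℕ
x mod zero = x
x mod suc k = x % suc k

_div_ : ℕ → ℕ → ℕ
x div zero = 0
x div suc k = x / suc k

-- r' (depends on c); meant for 1 ≤ r ≤ 2c, c ≥ 3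
r′ : ℕ → ℕ → ℕ
r′ c r =
  if does (r ≟ 1) then 1 else
  if does (r ≟ 2) then 2 else
  if does (r ≟ 2 * c ∸ 1) then 5 else
  if does (r ≟ 2 * c) then 6 else
  if does (r mod 2 ≟ 1) then 3 else 4

-- φ_p(n): n = 2cq + r + p - 1 with q ≥ 0, 1 ≤ r ≤ 2c, i.e.
-- q = (n - p) div 2c, r = (n - p) mod 2c + 1   (for n ≥ p)
φ : ℕ → ℕ → ℕ → ℕ
φ c p n = 6 * q + r′ c r + p ∸ 1
  where
    q = (n ∸ p) div (2 * c)
    r = (n ∸ p) mod (2 * c) + 1

Innumber : ℕ → ℕ → Set
Innumber e x = 0 < x × (x mod (2 * e) ≡ 1 ⊎ x mod (12 * e) ≡ 4 * e + 2)

Outnumber : ℕ → ℕ → Set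
Outnumber e x = 0 < x × (x mod (2 * e) ≡ 0 ⊎ x mod (12 * e) ≡ 4 * e + 1)

IsFloor : ℕ → ℕ → ℕ → Set
IsFloor c h x = Innumber c x × x ≤ h × (∀ y → Innumber c y → y ≤ h → y ≤ x)

IsCeil : ℕ → ℕ → ℕ → Set
IsCeil c h x = Outnumber c x × h ≤ x × (∀ y → Outnumber c y → h ≤ y → x ≤ y)

-- the p = 3 exception in ⌊O⌋: given the vector of pointwise floors,
-- produce ⌊O⌋
adjFloor : ∀ {p} → ℕ → Vec ℕ p → Vec ℕ p
adjFloor c (x ∷ y ∷ z ∷ []) =
  if does (x mod (2 * c) ≟ 2) ∧ does (y mod (2 * c) ≟ 2) ∧ does (z mod (2 * c) ≟ 2)
  then (x ∸ 1 ∷ y ∸ 1 ∷ z ∷ [])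
  else (x ∷ y ∷ z ∷ [])
adjFloor c v = v

IsPartition : ∀ {p} → Vec ℕ p → ℕ → Set
IsPartition O n = All (0 <_) O × sum O ≡ n

PartA : ℕ → Set
PartA c = ∀ p n → 1 ≤ p → p ≤ n → φ c p n mod 2 ≡ n mod 2

BijOn : (ℕ → ℕ) → (ℕ → Set) → (ℕ → Set) → Set
BijOn f P Q =
  (∀ x → P x → Q (f x)) ×
  (∀ x y → P x → P y → f x ≡ f y → x ≡ y) ×
  (∀ y → Q y → ∃[ x ] (P x × f x ≡ y))

PartB : ℕ → Set
PartB c = BijOn (φ c 1) (Innumber c) (Innumber 3)
        × BijOn (φ c 1) (Outnumber c) (Outnumber 3)

PartC : ℕ → Set
PartC c = ∀ p (h : Vec ℕ p) → 2 ≤ p → p ≤ 4 →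
  (All (Innumber c) h ⊎ All (Outnumber c) h) →
  ¬ (p ≡ 4 × All (λ x → x mod (2 * c) ≡ 2) h) →
  sum (map (φ c 1) h) ≡ φ c p (sum h)

PartD : ℕ → Set
PartD c = ∀ p n a b (O fl cl : Vec ℕ p) → 1 ≤ p → p ≤ 3 →
  IsPartition O n →
  Pointwise (IsFloor c) O fl → Pointwise (IsCeil c) O cl →
  IsPartition (adjFloor c fl) a → IsPartition cl b →
  φ c p a ≤ φ c p n × φ c p n ≤ φ c p b

{-# OPTIONS --safe #-}

-- Write n = p + (s + q·2c) with s < 2c, so that φ_p(n) = 6q + r′(s + 1) + p − 1.
-- Innumbers (outnumbers) for e are exactly the numbers 1 + (j + k·2e) (resp. j + k·2e)
-- whose digit j ∈ {0,1} and block k range over sets independent of e. As r′ is the identity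
-- on 1..4 and r′(2c − e) = 6 − e for e ≤ 3, φ₁ merely replaces the base 2c by 6 in these forms,
-- which gives (b); (a) holds because r′(r) ≡ r (mod 2). A sum of p such numbers keeps the
-- shape, with digit sum J ≤ p; for innumbers J ≤ 3 outside the excluded case, and for
-- outnumbers the block sum is at least p, so in both cases φ_p of the sum is again read off in
-- base 6, giving (c). For (d), the sum of the floors has digit at most 2 (after the p = 3
-- adjustment), where r′ is minimal, while the sum of the ceilings has digit 0 or at least
-- 2c − 3, where r′ is maximal.
module Submission where

open import Defs
open import Data.Nat using (ℕ; zero; suc; _+_; _*_; _∸_; _≤_; _<_; _≡ᵇ_; z≤n; s≤s; NonZero)
open import Data.Nat.Properties
open import Data.Nat.DivMod using (_%_; _/_; m≡m%n+[m/n]*n; [m+kn]%n≡m%n; m<n⇒m%n≡m; m%n<n; %-distribˡ-+)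
open import Data.Nat.Tactic.RingSolver using (solve-∀)
open import Data.Bool using (true; false)
open import Data.Product using (_×_; _,_; ∃-syntax; ∃₂; proj₁; proj₂)
open import Data.Sum using (_⊎_; inj₁; inj₂)
open import Data.Empty using (⊥-elim)
open import Function using (_∘_; id)
open import Relation.Nullary using (¬_)
open import Relation.Binary using (tri<; tri≈; tri>)
open import Relation.Binary.PropositionalEquality
  using (_≡_; _≢_; refl; sym; trans; cong; cong₂; subst; subst₂; module ≡-Reasoning)
open import Data.Vec using (Vec; []; _∷_; sum; map)
open import Data.Vec.Properties using (map-∘; map-cong)
open import Data.Vec.Relation.Unary.All as All using (All; []; _∷_)
open import Data.Vec.Relation.Unary.All.Properties using (map⁺; map⁻)
open import Data.Vec.Relation.Binary.Pointwise.Inductive as Pointwise using (Pointwise; []; _∷_)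

m<n⇒[m+kn]%n≡m : ∀ {m n} k .{{_ : NonZero n}} → m < n → (m + k * n) % n ≡ m
m<n⇒[m+kn]%n≡m {m} {n} k m<n = trans ([m+kn]%n≡m%n m k n) (m<n⇒m%n≡m m<n)

digits-injective : ∀ {B j j′ k k′} .{{_ : NonZero B}} →
  j < B → j′ < B → j + k * B ≡ j′ + k′ * B → j ≡ j′ × k ≡ k′
digits-injective {B} {j} {j′} {k} {k′} j<B j′<B eq =
  j≡j′ , *-cancelʳ-≡ k k′ B (+-cancelˡ-≡ j _ _ (trans eq (cong (_+ k′ * B) (sym j≡j′))))
  where
  open ≡-Reasoning
  j≡j′ : j ≡ j′
  j≡j′ = begin
    j                 ≡⟨ m<n⇒[m+kn]%n≡m k j<B ⟨
    (j + k * B) % B   ≡⟨ cong (_% B) eq ⟩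
    (j′ + k′ * B) % B ≡⟨ m<n⇒[m+kn]%n≡m k′ j′<B ⟩
    j′                ∎

m<n⇒[m+kn]/n≡k : ∀ {m n} k .{{_ : NonZero n}} → m < n → (m + k * n) / n ≡ k
m<n⇒[m+kn]/n≡k {m} {n} k m<n =
  sym (proj₂ (digits-injective m<n (m%n<n (m + k * n) n) (m≡m%n+[m/n]*n (m + k * n) n)))

%2-+-congʳ : ∀ {a b} c → a % 2 ≡ b % 2 → (a + c) % 2 ≡ (b + c) % 2
%2-+-congʳ {a} {b} c eq = begin
  (a + c) % 2           ≡⟨ %-distribˡ-+ a c 2 ⟩
  (a % 2 + c % 2) % 2   ≡⟨ cong (λ x → (x + c % 2) % 2) eq ⟩
  (b % 2 + c % 2) % 2   ≡⟨ %-distribˡ-+ b c 2 ⟨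
  (b + c) % 2           ∎
  where open ≡-Reasoning

%2-+-cancelʳ : ∀ {a b} c → (a + c) % 2 ≡ (b + c) % 2 → a % 2 ≡ b % 2
%2-+-cancelʳ {a} {b} c eq = begin
  a % 2             ≡⟨ [m+kn]%n≡m%n a c 2 ⟨
  (a + c * 2) % 2   ≡⟨ cong (_% 2) (double a c) ⟩
  (a + c + c) % 2   ≡⟨ %2-+-congʳ {a + c} {b + c} c eq ⟩
  (b + c + c) % 2   ≡⟨ cong (_% 2) (double b c) ⟨
  (b + c * 2) % 2   ≡⟨ [m+kn]%n≡m%n b c 2 ⟩
  b % 2             ∎
  where
  open ≡-Reasoning
  double : ∀ x y → x + y * 2 ≡ x + y + y
  double = solve-∀

%2≢1⇒%2≡0 : ∀ a → a % 2 ≢ 1 → a % 2 ≡ 0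
%2≢1⇒%2≡0 a ≢1 with a % 2 | m%n<n a 2
... | 0 | _ = refl
... | 1 | _ = ⊥-elim (≢1 refl)
... | suc (suc _) | s≤s (s≤s ())

-- inj₁ q and inj₂ m index the residue classes 1 and 4e + 2 (for outnumbers: 0 and 4e + 1)
-- that define innumbers (outnumbers) for e; the latter has digit 1 and block 2 + 6m in base 2e.
digit : ℕ ⊎ ℕ → ℕ
digit (inj₁ _) = 0
digit (inj₂ _) = 1

inBlock : ℕ ⊎ ℕ → ℕ
inBlock (inj₁ q) = q
inBlock (inj₂ m) = 2 + 6 * m

outBlock : ℕ ⊎ ℕ → ℕ
outBlock (inj₁ q) = suc q
outBlock (inj₂ m) = 2 + 6 * m

inNumber : ℕ → ℕ ⊎ ℕ → ℕ
inNumber e i = 1 + (digit i + inBlock i * (2 * e))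

outNumber : ℕ → ℕ ⊎ ℕ → ℕ
outNumber e i = digit i + outBlock i * (2 * e)

Parametrises : {I : Set} → (I → ℕ) → (ℕ → Set) → Set
Parametrises g P = (∀ i → P (g i)) × (∀ {x} → P x → ∃[ i ] x ≡ g i)

digit≤1 : ∀ i → digit i ≤ 1
digit≤1 (inj₁ _) = z≤n
digit≤1 (inj₂ _) = s≤s z≤n

1≤outBlock : ∀ i → 1 ≤ outBlock i
1≤outBlock (inj₁ _) = s≤s z≤n
1≤outBlock (inj₂ _) = s≤s z≤n

digit-inBlock-injective : ∀ {i i′} → digit i ≡ digit i′ → inBlock i ≡ inBlock i′ → i ≡ i′
digit-inBlock-injective {inj₁ _} {inj₁ _} _ refl = refl
digit-inBlock-injective {inj₂ m} {inj₂ m′} _ eq = cong inj₂ (*-cancelˡ-≡ m m′ 6 (+-cancelˡ-≡ 2 _ _ eq))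

digit-outBlock-injective : ∀ {i i′} → digit i ≡ digit i′ → outBlock i ≡ outBlock i′ → i ≡ i′
digit-outBlock-injective {inj₁ _} {inj₁ _} _ refl = refl
digit-outBlock-injective {inj₂ m} {inj₂ m′} _ eq = cong inj₂ (*-cancelˡ-≡ m m′ 6 (+-cancelˡ-≡ 2 _ _ eq))

module _ (k : ℕ) where
  private
    e : ℕ
    e = 2 + k

  1+digit<2e : ∀ i → 1 + digit i < 2 * e
  1+digit<2e i = ≤-trans (s≤s (s≤s (digit≤1 i))) (≤-trans (n≤1+n 3) (*-monoʳ-≤ 2 (m≤m+n 2 k)))

  digit<2e : ∀ i → digit i < 2 * e
  digit<2e i = <-trans (n<1+n (digit i)) (1+digit<2e i)

  4e+2<12e : 4 * e + 2 < 12 * e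
  4e+2<12e = subst (suc (4 * e + 2) ≤_) (expand k) (m≤m+n _ _)
    where
    expand : ∀ k → suc (4 * (2 + k) + 2) + (13 + 8 * k) ≡ 12 * (2 + k)
    expand = solve-∀

  inNumber-residue : ∀ m → 4 * e + 2 + m * (12 * e) ≡ inNumber e (inj₂ m)
  inNumber-residue m = expand e m
    where
    expand : ∀ e m → 4 * e + 2 + m * (12 * e) ≡ 1 + (1 + (2 + 6 * m) * (2 * e))
    expand = solve-∀

  outNumber-residue : ∀ m → 4 * e + 1 + m * (12 * e) ≡ outNumber e (inj₂ m)
  outNumber-residue m = expand e m
    where
    expand : ∀ e m → 4 * e + 1 + m * (12 * e) ≡ 1 + (2 + 6 * m) * (2 * e)
    expand = solve-∀

  inNumber-mod : ∀ i → inNumber e i mod (2 * e) ≡ 1 + digit i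
  inNumber-mod i = m<n⇒[m+kn]%n≡m (inBlock i) (1+digit<2e i)

  digit≡1⇒mod≡2 : ∀ {p} {ιs : Vec (ℕ ⊎ ℕ) p} →
    All (_≡ 1) (map digit ιs) → All (λ x → x mod (2 * e) ≡ 2) (map (inNumber e) ιs)
  digit≡1⇒mod≡2 ds≡1 = map⁺ (All.map (λ {i} d≡1 → trans (inNumber-mod i) (cong suc d≡1)) (map⁻ ds≡1))

  mod≡2⇒digit≡1 : ∀ {p} {ιs : Vec (ℕ ⊎ ℕ) p} →
    All (λ x → x mod (2 * e) ≡ 2) (map (inNumber e) ιs) → All (_≡ 1) (map digit ιs)
  mod≡2⇒digit≡1 xs≡2 = map⁺ (All.map (λ {i} x≡2 → suc-injective (trans (sym (inNumber-mod i)) x≡2)) (map⁻ xs≡2))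

  inNumber-parametrises : Parametrises (inNumber e) (Innumber e)
  inNumber-parametrises = inNumber-Innumber , Innumber⇒inNumber
    where
    inNumber-Innumber : ∀ i → Innumber e (inNumber e i)
    inNumber-Innumber (inj₁ q) = s≤s z≤n , inj₁ (inNumber-mod (inj₁ q))
    inNumber-Innumber (inj₂ m) = s≤s z≤n ,
      inj₂ (subst (λ x → x mod (12 * e) ≡ 4 * e + 2) (inNumber-residue m) (m<n⇒[m+kn]%n≡m m 4e+2<12e))

    Innumber⇒inNumber : ∀ {x} → Innumber e x → ∃[ i ] x ≡ inNumber e i
    Innumber⇒inNumber {x} (_ , inj₁ x%≡1) =
      inj₁ (x / (2 * e)) , trans (m≡m%n+[m/n]*n x (2 * e)) (cong (_+ x / (2 * e) * (2 * e)) x%≡1)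
    Innumber⇒inNumber {x} (_ , inj₂ x%≡) = inj₂ m ,
      trans (m≡m%n+[m/n]*n x (12 * e)) (trans (cong (_+ m * (12 * e)) x%≡) (inNumber-residue m))
      where m = x / (12 * e)

  outNumber-parametrises : Parametrises (outNumber e) (Outnumber e)
  outNumber-parametrises = outNumber-Outnumber , Outnumber⇒outNumber
    where
    outNumber-Outnumber : ∀ i → Outnumber e (outNumber e i)
    outNumber-Outnumber (inj₁ q) = s≤s z≤n , inj₁ (m<n⇒[m+kn]%n≡m {0} {2 * e} (suc q) (s≤s z≤n))
    outNumber-Outnumber (inj₂ m) = s≤s z≤n ,
      inj₂ (subst (λ x → x mod (12 * e) ≡ 4 * e + 1) (outNumber-residue m) (m<n⇒[m+kn]%n≡m m (<-trans (n<1+n (4 * e + 1)) (subst (_< 12 * e) (+-suc (4 * e) 1) 4e+2<12e))))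

    positive-multiple : ∀ {x} q → 0 < x → x ≡ q * (2 * e) → ∃[ i ] x ≡ outNumber e i
    positive-multiple zero 0<x refl = ⊥-elim (<-irrefl refl 0<x)
    positive-multiple (suc q) _ x≡ = inj₁ q , x≡

    Outnumber⇒outNumber : ∀ {x} → Outnumber e x → ∃[ i ] x ≡ outNumber e i
    Outnumber⇒outNumber {x} (0<x , inj₁ x%≡0) =
      positive-multiple (x / (2 * e)) 0<x (trans (m≡m%n+[m/n]*n x (2 * e)) (cong (_+ x / (2 * e) * (2 * e)) x%≡0))
    Outnumber⇒outNumber {x} (_ , inj₂ x%≡) = inj₂ m ,
      trans (m≡m%n+[m/n]*n x (12 * e)) (trans (cong (_+ m * (12 * e)) x%≡) (outNumber-residue m))
      where m = x / (12 * e)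

  inNumber-injective : ∀ {i i′} → inNumber e i ≡ inNumber e i′ → i ≡ i′
  inNumber-injective {i} {i′} eq =
    let j≡ , k≡ = digits-injective (digit<2e i) (digit<2e i′) (suc-injective eq)
    in digit-inBlock-injective j≡ k≡

  outNumber-injective : ∀ {i i′} → outNumber e i ≡ outNumber e i′ → i ≡ i′
  outNumber-injective {i} {i′} eq =
    let j≡ , k≡ = digits-injective (digit<2e i) (digit<2e i′) eq
    in digit-outBlock-injective j≡ k≡

parametrised⇒BijOn : ∀ {I : Set} {f : ℕ → ℕ} {g h : I → ℕ} {P Q : ℕ → Set} →
  Parametrises g P → Parametrises h Q → (∀ {i j} → h i ≡ h j → i ≡ j) →
  (∀ i → f (g i) ≡ h i) → BijOn f P Q
parametrised⇒BijOn {f = f} {g} {h} {P} {Q} (Pg , P⇒g) (Qh , Q⇒h) h-injective f∘g≗h =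
  maps , injective , surjective
  where
  maps : ∀ x → P x → Q (f x)
  maps x Px with P⇒g Px
  ... | i , refl = subst Q (sym (f∘g≗h i)) (Qh i)

  injective : ∀ x y → P x → P y → f x ≡ f y → x ≡ y
  injective x y Px Py fx≡fy with P⇒g Px | P⇒g Py
  ... | i , refl | j , refl = cong g (h-injective (trans (sym (f∘g≗h i)) (trans fx≡fy (f∘g≗h j))))

  surjective : ∀ y → Q y → ∃[ x ] (P x × f x ≡ y)
  surjective y Qy with Q⇒h Qy
  ... | i , refl = g i , Pg i , f∘g≗h i

All-parametrised : ∀ {I : Set} {g : I → ℕ} {P : ℕ → Set} {p} {xs : Vec ℕ p} →
  (∀ {x} → P x → ∃[ i ] x ≡ g i) → All P xs → ∃[ ιs ] xs ≡ map g ιs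
All-parametrised P⇒g [] = [] , refl
All-parametrised P⇒g (px ∷ pxs) with P⇒g px | All-parametrised P⇒g pxs
... | i , refl | ιs , refl = i ∷ ιs , refl

Pointwise⇒Allʳ : ∀ {R : ℕ → ℕ → Set} {P : ℕ → Set} {p} {xs ys : Vec ℕ p} →
  (∀ {x y} → R x y → P y) → Pointwise R xs ys → All P ys
Pointwise⇒Allʳ R⇒P [] = []
Pointwise⇒Allʳ R⇒P (r ∷ rs) = R⇒P r ∷ Pointwise⇒Allʳ R⇒P rs

sum-mono-≤ : ∀ {R : ℕ → ℕ → Set} {p} {xs ys : Vec ℕ p} →
  (∀ {x y} → R x y → x ≤ y) → Pointwise R xs ys → sum xs ≤ sum ys
sum-mono-≤ R⇒≤ [] = z≤n
sum-mono-≤ R⇒≤ (r ∷ rs) = +-mono-≤ (R⇒≤ r) (sum-mono-≤ R⇒≤ rs)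

sum-inNumber : ∀ e {p} (ιs : Vec (ℕ ⊎ ℕ) p) →
  sum (map (inNumber e) ιs) ≡ p + (sum (map digit ιs) + sum (map inBlock ιs) * (2 * e))
sum-inNumber e [] = refl
sum-inNumber e {suc p} (i ∷ ιs) =
  trans (cong (inNumber e i +_) (sum-inNumber e ιs))
        (regroup (digit i) (inBlock i) p (sum (map digit ιs)) (sum (map inBlock ιs)) (2 * e))
  where
  regroup : ∀ j k p J K B → 1 + (j + k * B) + (p + (J + K * B)) ≡ suc p + ((j + J) + (k + K) * B)
  regroup = solve-∀

sum-outNumber : ∀ e {p} (ιs : Vec (ℕ ⊎ ℕ) p) →
  sum (map (outNumber e) ιs) ≡ sum (map digit ιs) + sum (map outBlock ιs) * (2 * e)
sum-outNumber e [] = refl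
sum-outNumber e (i ∷ ιs) =
  trans (cong (outNumber e i +_) (sum-outNumber e ιs))
        (regroup (digit i) (outBlock i) (sum (map digit ιs)) (sum (map outBlock ιs)) (2 * e))
  where
  regroup : ∀ j k J K B → j + k * B + (J + K * B) ≡ (j + J) + (k + K) * B
  regroup = solve-∀

sum≤length : ∀ {p} {xs : Vec ℕ p} → All (_≤ 1) xs → sum xs ≤ p
sum≤length [] = z≤n
sum≤length (x≤1 ∷ xs≤1) = +-mono-≤ x≤1 (sum≤length xs≤1)

length≤sum : ∀ {p} {xs : Vec ℕ p} → All (1 ≤_) xs → p ≤ sum xs
length≤sum [] = z≤n
length≤sum (1≤x ∷ 1≤xs) = +-mono-≤ 1≤x (length≤sum 1≤xs)

sum≡length⇒All≡1 : ∀ {p} {xs : Vec ℕ p} → All (_≤ 1) xs → sum xs ≡ p → All (_≡ 1) xs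
sum≡length⇒All≡1 [] _ = []
sum≡length⇒All≡1 (z≤n ∷ xs≤1) Σ≡p = ⊥-elim (1+n≰n (subst (_≤ _) Σ≡p (sum≤length xs≤1)))
sum≡length⇒All≡1 (s≤s z≤n ∷ xs≤1) Σ≡p = refl ∷ sum≡length⇒All≡1 xs≤1 (suc-injective Σ≡p)

digits≤1 : ∀ {p} (ιs : Vec (ℕ ⊎ ℕ) p) → All (_≤ 1) (map digit ιs)
digits≤1 ιs = map⁺ (All.universal digit≤1 ιs)

1≤outBlocks : ∀ {p} (ιs : Vec (ℕ ⊎ ℕ) p) → All (1 ≤_) (map outBlock ιs)
1≤outBlocks ιs = map⁺ (All.universal 1≤outBlock ιs)

adjFloor-cases : ∀ c x y z → let v = x ∷ y ∷ z ∷ [] in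
  (All (λ w → w mod (2 * c) ≡ 2) v × adjFloor c v ≡ x ∸ 1 ∷ y ∸ 1 ∷ z ∷ []) ⊎
  (¬ All (λ w → w mod (2 * c) ≡ 2) v × adjFloor c v ≡ v)
adjFloor-cases c x y z with x mod (2 * c) ≡ᵇ 2 | ≡ᵇ⇒≡ (x mod (2 * c)) 2 | ≡⇒≡ᵇ (x mod (2 * c)) 2
... | false | _ | x≢2 = inj₂ ((λ { (x≡2 ∷ _) → x≢2 x≡2 }) , refl)
... | true | x≡2 | _ with y mod (2 * c) ≡ᵇ 2 | ≡ᵇ⇒≡ (y mod (2 * c)) 2 | ≡⇒≡ᵇ (y mod (2 * c)) 2
... | false | _ | y≢2 = inj₂ ((λ { (_ ∷ y≡2 ∷ _) → y≢2 y≡2 }) , refl)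
... | true | y≡2 | _ with z mod (2 * c) ≡ᵇ 2 | ≡ᵇ⇒≡ (z mod (2 * c)) 2 | ≡⇒≡ᵇ (z mod (2 * c)) 2
... | false | _ | z≢2 = inj₂ ((λ { (_ ∷ _ ∷ z≡2 ∷ _) → z≢2 z≡2 }) , refl)
... | true | z≡2 | _ = inj₁ ((x≡2 _ ∷ y≡2 _ ∷ z≡2 _ ∷ []) , refl)

2-or-3 : ∀ {e} → e ≤ 3 → e ≢ 0 → e ≢ 1 → e ≡ 2 ⊎ e ≡ 3
2-or-3 {0} _ e≢0 _ = ⊥-elim (e≢0 refl)
2-or-3 {1} _ _ e≢1 = ⊥-elim (e≢1 refl)
2-or-3 {2} _ _ _ = inj₁ refl
2-or-3 {3} _ _ _ = inj₂ refl
2-or-3 {suc (suc (suc (suc _)))} (s≤s (s≤s (s≤s ()))) _ _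

module _ (t : ℕ) where
  private
    c : ℕ
    c = 3 + t

  N : ℕ
  N = 2 * c

  N≡6+2t : N ≡ 6 + t * 2
  N≡6+2t = expand t
    where
    expand : ∀ t → 2 * (3 + t) ≡ 6 + t * 2
    expand = solve-∀

  6≤N : 6 ≤ N
  6≤N = *-monoʳ-≤ 2 (m≤m+n 3 t)

  ≤5⇒<N : ∀ {s} → s ≤ 5 → s < N
  ≤5⇒<N s≤5 = ≤-trans (s≤s s≤5) 6≤N

  N∸[1+e]+1≡N∸e : ∀ {e} → suc e ≤ N → N ∸ suc e + 1 ≡ N ∸ e
  N∸[1+e]+1≡N∸e 1+e≤N = trans (+-comm _ 1) (sym (+-∸-assoc 1 1+e≤N))

  6∸e≤N∸e : ∀ e → 6 ∸ e ≤ N ∸ e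
  6∸e≤N∸e e = ∸-monoˡ-≤ e 6≤N

  N∸-injective : ∀ {e e′} → e ≤ 6 → e′ ≤ 6 → N ∸ e ≡ N ∸ e′ → e ≡ e′
  N∸-injective e≤6 e′≤6 = ∸-cancelˡ-≡ (≤-trans e≤6 6≤N) (≤-trans e′≤6 6≤N)

  N∸-parity : ∀ {e} → e ≤ 6 → (N ∸ e) % 2 ≡ (6 ∸ e) % 2
  N∸-parity {e} e≤6 = begin
    (N ∸ e) % 2            ≡⟨ cong (λ n → (n ∸ e) % 2) N≡6+2t ⟩
    (6 + t * 2 ∸ e) % 2    ≡⟨ cong (_% 2) (+-∸-comm (t * 2) e≤6) ⟩
    (6 ∸ e + t * 2) % 2    ≡⟨ [m+kn]%n≡m%n (6 ∸ e) t 2 ⟩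
    (6 ∸ e) % 2            ∎
    where open ≡-Reasoning

  Interior : ℕ → Set
  Interior r = r ≢ 1 × r ≢ 2 × r ≢ N ∸ 1 × r ≢ N

  data R′View (r : ℕ) : ℕ → Set where
    one         : r ≡ 1 → R′View r 1
    two         : r ≡ 2 → R′View r 2
    penultimate : r ≡ N ∸ 1 → R′View r 5
    last        : r ≡ N → R′View r 6
    odd         : Interior r → r % 2 ≡ 1 → R′View r 3
    even        : Interior r → r % 2 ≡ 0 → R′View r 4

  r′-view : ∀ r → R′View r (r′ c r)
  r′-view r with r ≡ᵇ 1 | ≡ᵇ⇒≡ r 1 | ≡⇒≡ᵇ r 1
  ... | true  | r≡1 | _ = one (r≡1 _)
  ... | false | _ | r≢1 with r ≡ᵇ 2 | ≡ᵇ⇒≡ r 2 | ≡⇒≡ᵇ r 2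
  ... | true  | r≡2 | _ = two (r≡2 _)
  ... | false | _ | r≢2 with r ≡ᵇ N ∸ 1 | ≡ᵇ⇒≡ r (N ∸ 1) | ≡⇒≡ᵇ r (N ∸ 1)
  ... | true  | r≡N∸1 | _ = penultimate (r≡N∸1 _)
  ... | false | _ | r≢N∸1 with r ≡ᵇ N | ≡ᵇ⇒≡ r N | ≡⇒≡ᵇ r N
  ... | true  | r≡N | _ = last (r≡N _)
  ... | false | _ | r≢N with r % 2 ≡ᵇ 1 | ≡ᵇ⇒≡ (r % 2) 1 | ≡⇒≡ᵇ (r % 2) 1
  ... | true  | r%2≡1 | _ = odd (r≢1 , r≢2 , r≢N∸1 , r≢N) (r%2≡1 _)
  ... | false | _ | r%2≢1 = even (r≢1 , r≢2 , r≢N∸1 , r≢N) (%2≢1⇒%2≡0 r r%2≢1)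

  r′-parity : ∀ r → r′ c r % 2 ≡ r % 2
  r′-parity r with r′ c r | r′-view r
  ... | _ | one refl         = refl
  ... | _ | two refl         = refl
  ... | _ | penultimate refl = sym (N∸-parity (m≤n+m 1 5))
  ... | _ | last refl        = sym (N∸-parity {0} z≤n)
  ... | _ | odd _ r%2≡1      = sym r%2≡1
  ... | _ | even _ r%2≡0     = sym r%2≡0

  r′-lowerBound : ∀ {m r} → m ≤ 3 → m ≤ r → m ≤ r′ c r
  r′-lowerBound {m} {r} m≤3 m≤r with r′ c r | r′-view r
  ... | _ | one refl      = m≤r
  ... | _ | two refl      = m≤r
  ... | _ | penultimate _ = ≤-trans m≤3 (m≤m+n 3 2)
  ... | _ | last _        = ≤-trans m≤3 (m≤m+n 3 3)
  ... | _ | odd _ _       = m≤3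
  ... | _ | even _ _      = ≤-trans m≤3 (n≤1+n 3)

  r′-upperBound : ∀ {m r} → m ≤ 2 → r + m ≤ N → r′ c r + m ≤ 6
  r′-upperBound {m} {r} m≤2 r+m≤N with r′ c r | r′-view r
  ... | _ | one refl         = ≤-trans (+-monoʳ-≤ 1 m≤2) (m≤m+n 3 3)
  ... | _ | two refl         = ≤-trans (+-monoʳ-≤ 2 m≤2) (m≤m+n 4 2)
  ... | _ | penultimate refl = +-monoʳ-≤ 5 (+-cancelˡ-≤ (N ∸ 1) m 1
                                 (subst (N ∸ 1 + m ≤_) (sym (m∸n+n≡m (≤5⇒<N z≤n))) r+m≤N))
  ... | _ | last refl        = +-monoʳ-≤ 6 (+-cancelˡ-≤ N m 0 (subst (N + m ≤_) (sym (+-identityʳ N)) r+m≤N))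
  ... | _ | odd _ _          = ≤-trans (+-monoʳ-≤ 3 m≤2) (n≤1+n 5)
  ... | _ | even _ _         = +-monoʳ-≤ 4 m≤2

  private
    4<N∸e : ∀ {e} → e ≤ 1 → 4 < N ∸ e
    4<N∸e {e} e≤1 = ≤-trans (∸-monoʳ-≤ 6 e≤1) (6∸e≤N∸e e)

    3≤N∸e : ∀ {e} → e ≤ 3 → 3 ≤ N ∸ e
    3≤N∸e {e} e≤3 = ≤-trans (∸-monoʳ-≤ 6 e≤3) (6∸e≤N∸e e)

  r′-small : ∀ {s} → s ≤ 3 → r′ c (s + 1) ≡ s + 1
  r′-small {0} _ = refl
  r′-small {1} _ = refl
  r′-small {2} _ with r′ c 3 | r′-view 3
  ... | _ | one ()
  ... | _ | two ()
  ... | _ | penultimate 3≡N∸1 = ⊥-elim (<⇒≱ (4<N∸e (m≤n+m 1 0)) (subst (_≤ 4) 3≡N∸1 (n≤1+n 3)))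
  ... | _ | last 3≡N          = ⊥-elim (<⇒≱ (4<N∸e {0} z≤n) (subst (_≤ 4) 3≡N (n≤1+n 3)))
  ... | _ | odd _ _           = refl
  ... | _ | even _ ()
  r′-small {3} _ with r′ c 4 | r′-view 4
  ... | _ | one ()
  ... | _ | two ()
  ... | _ | penultimate 4≡N∸1 = ⊥-elim (<⇒≱ (4<N∸e (m≤n+m 1 0)) (subst (_≤ 4) 4≡N∸1 ≤-refl))
  ... | _ | last 4≡N          = ⊥-elim (<⇒≱ (4<N∸e {0} z≤n) (subst (_≤ 4) 4≡N ≤-refl))
  ... | _ | odd _ ()
  ... | _ | even _ _          = refl
  r′-small {suc (suc (suc (suc _)))} (s≤s (s≤s (s≤s ())))

  r′-top : ∀ {e} → e ≤ 3 → r′ c (N ∸ e) + e ≡ 6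
  r′-top {e} e≤3 with r′ c (N ∸ e) | r′-view (N ∸ e)
  ... | _ | one N∸e≡1         = ⊥-elim (<⇒≱ (s≤s (s≤s z≤n)) (subst (3 ≤_) N∸e≡1 (3≤N∸e e≤3)))
  ... | _ | two N∸e≡2         = ⊥-elim (<⇒≱ ≤-refl (subst (3 ≤_) N∸e≡2 (3≤N∸e e≤3)))
  ... | _ | penultimate N∸e≡N∸1 = cong (5 +_) (N∸-injective (≤-trans e≤3 (m≤m+n 3 3)) (m≤n+m 1 5) N∸e≡N∸1)
  ... | _ | last N∸e≡N        = cong (6 +_) (N∸-injective {e} {0} (≤-trans e≤3 (m≤m+n 3 3)) z≤n N∸e≡N)
  ... | _ | odd (_ , _ , ≢N∸1 , ≢N) N∸e%2≡1
        with 2-or-3 e≤3 (≢N ∘ cong (N ∸_)) (≢N∸1 ∘ cong (N ∸_))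
  ...   | inj₁ refl = ⊥-elim (0≢1+n (trans (sym (N∸-parity (≤-trans e≤3 (m≤m+n 3 3)))) N∸e%2≡1))
  ...   | inj₂ refl = refl
  r′-top {e} e≤3 | _ | even (_ , _ , ≢N∸1 , ≢N) N∸e%2≡0
        with 2-or-3 e≤3 (≢N ∘ cong (N ∸_)) (≢N∸1 ∘ cong (N ∸_))
  ...   | inj₁ refl = refl
  ...   | inj₂ refl = ⊥-elim (0≢1+n (trans (sym N∸e%2≡0) (N∸-parity (≤-trans e≤3 (m≤m+n 3 3)))))

  r′-mono-bottom : ∀ {s s′} → s ≤ 2 → s ≤ s′ → r′ c (s + 1) ≤ r′ c (s′ + 1)
  r′-mono-bottom {s} {s′} s≤2 s≤s′ =
    subst (_≤ r′ c (s′ + 1)) (sym (r′-small (≤-trans s≤2 (n≤1+n 2))))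
      (r′-lowerBound (+-monoˡ-≤ 1 s≤2) (+-monoˡ-≤ 1 s≤s′))

  r′-mono-top : ∀ {e r} → e ≤ 2 → r ≤ N ∸ e → r′ c r ≤ r′ c (N ∸ e)
  r′-mono-top {e} {r} e≤2 r≤N∸e = +-cancelʳ-≤ e (r′ c r) (r′ c (N ∸ e))
    (subst (r′ c r + e ≤_) (sym (r′-top (≤-trans e≤2 (n≤1+n 2))))
      (r′-upperBound e≤2 (subst (r + e ≤_) (m∸n+n≡m (<⇒≤ (≤5⇒<N (≤-trans e≤2 (m≤m+n 2 3))))) (+-monoˡ-≤ e r≤N∸e))))

  r′≤6 : ∀ {s} → s < N → r′ c (s + 1) ≤ 6
  r′≤6 {s} s<N = subst (_≤ 6) (+-identityʳ _)
    (r′-upperBound z≤n (subst (_≤ N) (sym (trans (+-identityʳ (s + 1)) (+-comm s 1))) s<N))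

  φ-digits : ∀ p {s} q → s < N → φ c p (p + (s + q * N)) ≡ 6 * q + r′ c (s + 1) + p ∸ 1
  φ-digits p {s} q s<N = cong₂ (λ q′ s′ → 6 * q′ + r′ c (s′ + 1) + p ∸ 1)
    (trans (cong (_/ N) (m+n∸m≡n p _)) (m<n⇒[m+kn]/n≡k q s<N))
    (trans (cong (_% N) (m+n∸m≡n p _)) (m<n⇒[m+kn]%n≡m q s<N))

  digits-of : ∀ {p n} → p ≤ n → ∃₂ λ s q → s < N × n ≡ p + (s + q * N)
  digits-of {p} {n} p≤n = (n ∸ p) % N , (n ∸ p) / N , m%n<n (n ∸ p) N ,
    trans (sym (m+[n∸m]≡n p≤n)) (cong (p +_) (m≡m%n+[m/n]*n (n ∸ p) N))

  boundary-digits : ∀ j e q → suc e ≤ N → j + suc q * N ≡ suc (j + e) + ((N ∸ suc e) + q * N)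
  boundary-digits j e q 1+e≤N = begin
    j + (N + q * N)                              ≡⟨ cong (λ n → j + (n + q * N)) (m+[n∸m]≡n 1+e≤N) ⟨
    j + ((suc e + (N ∸ suc e)) + q * N)          ≡⟨ regroup j e (N ∸ suc e) (q * N) ⟩
    suc (j + e) + ((N ∸ suc e) + q * N)          ∎
    where
    open ≡-Reasoning
    regroup : ∀ j e n m → j + ((suc e + n) + m) ≡ suc (j + e) + (n + m)
    regroup = solve-∀

  φ-low : ∀ p {s} q → s ≤ 3 → φ c p (p + (s + q * N)) ≡ p + (s + q * 6)
  φ-low p {s} q s≤3 = begin
    φ c p (p + (s + q * N))        ≡⟨ φ-digits p q (≤5⇒<N (≤-trans s≤3 (m≤m+n 3 2))) ⟩
    6 * q + r′ c (s + 1) + p ∸ 1   ≡⟨ cong (λ r → 6 * q + r + p ∸ 1) (r′-small s≤3) ⟩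
    6 * q + (s + 1) + p ∸ 1        ≡⟨ cong (_∸ 1) (regroup q s p) ⟩
    p + (s + q * 6)                ∎
    where
    open ≡-Reasoning
    regroup : ∀ q s p → 6 * q + (s + 1) + p ≡ suc (p + (s + q * 6))
    regroup = solve-∀

  φ-boundary : ∀ j {e} q → e ≤ 3 → φ c (suc (j + e)) (j + suc q * N) ≡ j + suc q * 6
  φ-boundary j {e} q e≤3 = begin
    φ c p (j + suc q * N)                       ≡⟨ cong (φ c p) (boundary-digits j e q 1+e≤N) ⟩
    φ c p (p + ((N ∸ suc e) + q * N))           ≡⟨ φ-digits p q (∸-monoʳ-< (s≤s z≤n) 1+e≤N) ⟩
    6 * q + r′ c (N ∸ suc e + 1) + p ∸ 1        ≡⟨ cong (λ r → 6 * q + r′ c r + p ∸ 1) (N∸[1+e]+1≡N∸e 1+e≤N) ⟩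
    6 * q + r′ c (N ∸ e) + p ∸ 1                ≡⟨ cong (_∸ 1) (regroup q (r′ c (N ∸ e)) j e) ⟩
    j + (r′ c (N ∸ e) + e + q * 6)              ≡⟨ cong (λ x → j + (x + q * 6)) (r′-top e≤3) ⟩
    j + suc q * 6                               ∎
    where
    open ≡-Reasoning
    p : ℕ
    p = suc (j + e)
    1+e≤N : suc e ≤ N
    1+e≤N = ≤5⇒<N (≤-trans e≤3 (m≤m+n 3 2))
    regroup : ∀ q r j e → 6 * q + r + suc (j + e) ≡ suc (j + (r + e + q * 6))
    regroup = solve-∀

  φ-outDigits : ∀ {p j k} → j ≤ p → 1 ≤ p → p ≤ 4 → p ≤ k → φ c p (j + k * N) ≡ j + k * 6
  φ-outDigits {p} {j} {k} j≤p 1≤p p≤4 p≤k with m≤n⇒m<n∨m≡n j≤p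
  ... | inj₂ refl = φ-low j k z≤n
  ... | inj₁ j<p with m≤n⇒∃[o]m+o≡n j<p | ≤-trans 1≤p p≤k
  ...   | e , refl | s≤s {n = q} _ = φ-boundary j q (≤-trans (m≤n+m e j) (≤-pred p≤4))

  φ-mono-digits : ∀ p {s s′} q q′ → s < N → s′ < N → s + q * N ≤ s′ + q′ * N →
    (s ≤ s′ → r′ c (s + 1) ≤ r′ c (s′ + 1)) →
    φ c p (p + (s + q * N)) ≤ φ c p (p + (s′ + q′ * N))
  φ-mono-digits p {s} {s′} q q′ s<N s′<N a≤b r′-mono =
    subst₂ _≤_ (sym (φ-digits p q s<N)) (sym (φ-digits p q′ s′<N))
      (∸-monoˡ-≤ 1 (+-monoˡ-≤ p leading))
    where
    open ≤-Reasoning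
    leading : 6 * q + r′ c (s + 1) ≤ 6 * q′ + r′ c (s′ + 1)
    leading with <-cmp q q′
    ... | tri< q<q′ _ _ = begin
      6 * q + r′ c (s + 1)     ≤⟨ +-monoʳ-≤ (6 * q) (r′≤6 s<N) ⟩
      6 * q + 6                ≡⟨ trans (+-comm (6 * q) 6) (sym (*-suc 6 q)) ⟩
      6 * suc q                ≤⟨ *-monoʳ-≤ 6 q<q′ ⟩
      6 * q′                   ≤⟨ m≤m+n (6 * q′) _ ⟩
      6 * q′ + r′ c (s′ + 1)   ∎
    ... | tri≈ _ refl _ = +-monoʳ-≤ (6 * q) (r′-mono (+-cancelʳ-≤ (q * N) s s′ a≤b))
    ... | tri> _ _ q′<q = ⊥-elim (<⇒≱ (begin-strict
      s′ + q′ * N              <⟨ +-monoˡ-< (q′ * N) s′<N ⟩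
      suc q′ * N               ≤⟨ *-monoˡ-≤ N q′<q ⟩
      q * N                    ≤⟨ m≤n+m (q * N) s ⟩
      s + q * N                ∎) a≤b)

  φ-≤-lowDigit : ∀ p {s} q {n} → s ≤ 2 → p + (s + q * N) ≤ n → φ c p (p + (s + q * N)) ≤ φ c p n
  φ-≤-lowDigit p {s} q {n} s≤2 a≤n with digits-of {p} {n} (≤-trans (m≤m+n p _) a≤n)
  ... | s′ , q′ , s′<N , refl = φ-mono-digits p q q′ (≤5⇒<N (≤-trans s≤2 (m≤m+n 2 3))) s′<N
    (+-cancelˡ-≤ p _ _ a≤n) (r′-mono-bottom s≤2)

  φ-≤-boundary : ∀ j {e q n} → e ≤ 2 → suc (j + e) ≤ n → n ≤ j + suc q * N →
    φ c (suc (j + e)) n ≤ φ c (suc (j + e)) (j + suc q * N)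
  φ-≤-boundary j {e} {q} {n} e≤2 p≤n n≤b with digits-of p≤n
  ... | s′ , q′ , s′<N , refl =
    subst (λ b → φ c p n ≤ φ c p b) (sym (boundary-digits j e q 1+e≤N))
      (φ-mono-digits p q′ q s′<N (∸-monoʳ-< (s≤s z≤n) 1+e≤N)
        (+-cancelˡ-≤ p _ _ (subst (n ≤_) (boundary-digits j e q 1+e≤N) n≤b))
        λ s′≤ → subst (r′ c (s′ + 1) ≤_) (cong (r′ c) (sym (N∸[1+e]+1≡N∸e 1+e≤N)))
                  (r′-mono-top e≤2 (subst (s′ + 1 ≤_) (N∸[1+e]+1≡N∸e 1+e≤N) (+-monoˡ-≤ 1 s′≤))))
    where
    p : ℕ
    p = suc (j + e)
    1+e≤N : suc e ≤ N
    1+e≤N = ≤5⇒<N (≤-trans e≤2 (m≤m+n 2 3))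

  φ-≤-outDigits : ∀ {p j k n} → j ≤ p → 1 ≤ p → p ≤ 3 → p ≤ k → p ≤ n → n ≤ j + k * N →
    φ c p n ≤ φ c p (j + k * N)
  φ-≤-outDigits {p} {j} {k} {n} j≤p 1≤p p≤3 p≤k p≤n n≤b with m≤n⇒m<n∨m≡n j≤p
  ... | inj₂ refl with digits-of p≤n
  ...   | s′ , q′ , s′<N , refl =
    φ-mono-digits p q′ k s′<N (≤5⇒<N z≤n) (+-cancelˡ-≤ p _ _ n≤b) λ { z≤n → ≤-refl }
  φ-≤-outDigits {p} {j} {k} {n} j≤p 1≤p p≤3 p≤k p≤n n≤b | inj₁ j<p
    with m≤n⇒∃[o]m+o≡n j<p | ≤-trans 1≤p p≤k
  ... | e , refl | s≤s {n = q} _ = φ-≤-boundary j {e} {q} (≤-trans (m≤n+m e j) (≤-pred p≤3)) p≤n n≤b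

  φ-parity : PartA c
  φ-parity p n _ p≤n with digits-of p≤n
  ... | s , q , s<N , refl = %2-+-cancelʳ {φ c p n′} {n′} 1 (begin
    (φ c p n′ + 1) % 2             ≡⟨ cong (λ x → (x + 1) % 2) (φ-digits p q s<N) ⟩
    (6 * q + R + p ∸ 1 + 1) % 2    ≡⟨ cong (_% 2) (m∸n+n≡m 1≤sum) ⟩
    (6 * q + R + p) % 2            ≡⟨ cong (_% 2) (regroup q R p) ⟩
    (R + p + 3 * q * 2) % 2        ≡⟨ [m+kn]%n≡m%n (R + p) (3 * q) 2 ⟩
    (R + p) % 2                    ≡⟨ %2-+-congʳ {R} {s + 1} p (r′-parity (s + 1)) ⟩
    (s + 1 + p) % 2                ≡⟨ [m+kn]%n≡m%n (s + 1 + p) (q * c) 2 ⟨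
    (s + 1 + p + q * c * 2) % 2    ≡⟨ cong (_% 2) (regroup′ s p q c) ⟩
    (n′ + 1) % 2                   ∎)
    where
    open ≡-Reasoning
    n′ R : ℕ
    n′ = p + (s + q * N)
    R = r′ c (s + 1)
    1≤sum : 1 ≤ 6 * q + R + p
    1≤sum = ≤-trans (r′-lowerBound (s≤s z≤n) (m≤n+m 1 s)) (≤-trans (m≤n+m R (6 * q)) (m≤m+n _ p))
    regroup : ∀ q R p → 6 * q + R + p ≡ R + p + 3 * q * 2
    regroup = solve-∀
    regroup′ : ∀ s p q c → s + 1 + p + q * c * 2 ≡ p + (s + q * (2 * c)) + 1
    regroup′ = solve-∀

  φ₁-inNumber : ∀ i → φ c 1 (inNumber c i) ≡ inNumber 3 i
  φ₁-inNumber i = φ-low 1 (inBlock i) (≤-trans (digit≤1 i) (m≤m+n 1 2))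

  φ₁-outNumber : ∀ i → φ c 1 (outNumber c i) ≡ outNumber 3 i
  φ₁-outNumber i = φ-outDigits (digit≤1 i) ≤-refl (s≤s z≤n) (1≤outBlock i)

  φ₁-bijections : PartB c
  φ₁-bijections =
    parametrised⇒BijOn (inNumber-parametrises (1 + t)) (inNumber-parametrises 1)
      (inNumber-injective 1) φ₁-inNumber ,
    parametrised⇒BijOn (outNumber-parametrises (1 + t)) (outNumber-parametrises 1)
      (outNumber-injective 1) φ₁-outNumber

  φ-additive : PartC c
  φ-additive p h 2≤p p≤4 (inj₁ innumbers) not-exceptional
    with All-parametrised (proj₂ (inNumber-parametrises (1 + t))) innumbers
  ... | ιs , refl = begin
    sum (map (φ c 1) (map (inNumber c) ιs))   ≡⟨ cong sum (map-∘ (φ c 1) (inNumber c) ιs) ⟨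
    sum (map (φ c 1 ∘ inNumber c) ιs)         ≡⟨ cong sum (map-cong φ₁-inNumber ιs) ⟩
    sum (map (inNumber 3) ιs)                 ≡⟨ sum-inNumber 3 ιs ⟩
    p + (J + K * 6)                           ≡⟨ φ-low p K J≤3 ⟨
    φ c p (p + (J + K * N))                   ≡⟨ cong (φ c p) (sum-inNumber c ιs) ⟨
    φ c p (sum (map (inNumber c) ιs))         ∎
    where
    open ≡-Reasoning
    J K : ℕ
    J = sum (map digit ιs)
    K = sum (map inBlock ιs)
    J≤3 : J ≤ 3
    J≤3 with m≤n⇒m<n∨m≡n (≤-trans (sum≤length (digits≤1 ιs)) p≤4)
    ... | inj₁ J<4 = ≤-pred J<4
    ... | inj₂ J≡4 = ⊥-elim (not-exceptional (p≡4 ,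
          digit≡1⇒mod≡2 (1 + t) (sum≡length⇒All≡1 (digits≤1 ιs) (trans J≡4 (sym p≡4)))))
      where
      p≡4 : p ≡ 4
      p≡4 = ≤-antisym p≤4 (subst (_≤ p) J≡4 (sum≤length (digits≤1 ιs)))
  φ-additive p h 2≤p p≤4 (inj₂ outnumbers) _
    with All-parametrised (proj₂ (outNumber-parametrises (1 + t))) outnumbers
  ... | ιs , refl = begin
    sum (map (φ c 1) (map (outNumber c) ιs))  ≡⟨ cong sum (map-∘ (φ c 1) (outNumber c) ιs) ⟨
    sum (map (φ c 1 ∘ outNumber c) ιs)        ≡⟨ cong sum (map-cong φ₁-outNumber ιs) ⟩
    sum (map (outNumber 3) ιs)                ≡⟨ sum-outNumber 3 ιs ⟩
    J + K * 6                                 ≡⟨ φ-outDigits J≤p (≤-trans (s≤s z≤n) 2≤p) p≤4 p≤K ⟨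
    φ c p (J + K * N)                         ≡⟨ cong (φ c p) (sum-outNumber c ιs) ⟨
    φ c p (sum (map (outNumber c) ιs))        ∎
    where
    open ≡-Reasoning
    J K : ℕ
    J = sum (map digit ιs)
    K = sum (map outBlock ιs)
    J≤p : J ≤ p
    J≤p = sum≤length (digits≤1 ιs)
    p≤K : p ≤ K
    p≤K = length≤sum (1≤outBlocks ιs)

  φ-innumberSum-≤ : ∀ {p n} (ιs : Vec (ℕ ⊎ ℕ) p) → sum (map digit ιs) ≤ 2 →
    sum (map (inNumber c) ιs) ≤ n → φ c p (sum (map (inNumber c) ιs)) ≤ φ c p n
  φ-innumberSum-≤ {p} {n} ιs J≤2 a≤n =
    subst (λ a → φ c p a ≤ φ c p n) (sym (sum-inNumber c ιs))
      (φ-≤-lowDigit p (sum (map inBlock ιs)) J≤2 (subst (_≤ n) (sum-inNumber c ιs) a≤n))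

  -- Three floors ≡ 2 (mod 2c) have digit sum 3, which the adjustment of ⌊O⌋ lowers to 1.
  φ-adjustedTriple-≤ : ∀ {n i₁ i₂ i₃} → All (_≡ 1) (map digit (i₁ ∷ i₂ ∷ i₃ ∷ [])) →
    sum (map (inNumber c) (i₁ ∷ i₂ ∷ i₃ ∷ [])) ≤ n →
    φ c 3 (sum (inNumber c i₁ ∸ 1 ∷ inNumber c i₂ ∸ 1 ∷ inNumber c i₃ ∷ [])) ≤ φ c 3 n
  φ-adjustedTriple-≤ {i₁ = inj₁ _} (() ∷ _)
  φ-adjustedTriple-≤ {i₂ = inj₁ _} (_ ∷ () ∷ _)
  φ-adjustedTriple-≤ {i₃ = inj₁ _} (_ ∷ _ ∷ () ∷ _)
  φ-adjustedTriple-≤ {n} {inj₂ m₁} {inj₂ m₂} {inj₂ m₃} _ fl≤n =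
    subst (λ a → φ c 3 a ≤ φ c 3 n) (sym (adjusted k₁ k₂ k₃ N))
      (φ-≤-lowDigit 3 (k₁ + (k₂ + (k₃ + 0))) (s≤s z≤n) (≤-trans (m≤n+m _ 2) (subst (_≤ n) (unadjusted k₁ k₂ k₃ N) fl≤n)))
    where
    k₁ k₂ k₃ : ℕ
    k₁ = 2 + 6 * m₁
    k₂ = 2 + 6 * m₂
    k₃ = 2 + 6 * m₃
    adjusted : ∀ k₁ k₂ k₃ N →
      1 + k₁ * N + (1 + k₂ * N + (1 + (1 + k₃ * N) + 0)) ≡ 3 + (1 + (k₁ + (k₂ + (k₃ + 0))) * N)
    adjusted = solve-∀
    unadjusted : ∀ k₁ k₂ k₃ N →
      1 + (1 + k₁ * N) + (1 + (1 + k₂ * N) + (1 + (1 + k₃ * N) + 0))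
        ≡ 2 + (3 + (1 + (k₁ + (k₂ + (k₃ + 0))) * N))
    unadjusted = solve-∀

  φ-adjFloorSum-≤ : ∀ {p n} (ιs : Vec (ℕ ⊎ ℕ) p) → p ≤ 3 → sum (map (inNumber c) ιs) ≤ n →
    φ c p (sum (adjFloor c (map (inNumber c) ιs))) ≤ φ c p n
  φ-adjFloorSum-≤ [] _ = φ-innumberSum-≤ [] z≤n
  φ-adjFloorSum-≤ ιs@(_ ∷ []) _ = φ-innumberSum-≤ ιs (≤-trans (sum≤length (digits≤1 ιs)) (n≤1+n 1))
  φ-adjFloorSum-≤ ιs@(_ ∷ _ ∷ []) _ = φ-innumberSum-≤ ιs (sum≤length (digits≤1 ιs))
  φ-adjFloorSum-≤ ιs@(i₁ ∷ i₂ ∷ i₃ ∷ []) _ fl≤n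
    with adjFloor-cases c (inNumber c i₁) (inNumber c i₂) (inNumber c i₃)
  ... | inj₁ (all≡2 , adjusted) rewrite adjusted =
    φ-adjustedTriple-≤ {i₁ = i₁} {i₂} {i₃} (mod≡2⇒digit≡1 (1 + t) all≡2) fl≤n
  ... | inj₂ (not-all≡2 , unchanged) rewrite unchanged = φ-innumberSum-≤ ιs J≤2 fl≤n
    where
    J≤2 : sum (map digit ιs) ≤ 2
    J≤2 = ≤-pred (≤∧≢⇒< (sum≤length (digits≤1 ιs))
      (not-all≡2 ∘ digit≡1⇒mod≡2 (1 + t) ∘ sum≡length⇒All≡1 (digits≤1 ιs)))
  φ-adjFloorSum-≤ (_ ∷ _ ∷ _ ∷ _ ∷ _) (s≤s (s≤s (s≤s ())))

  φ-outnumberSum-≥ : ∀ {p n} (ιs : Vec (ℕ ⊎ ℕ) p) → 1 ≤ p → p ≤ 3 → p ≤ n →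
    n ≤ sum (map (outNumber c) ιs) → φ c p n ≤ φ c p (sum (map (outNumber c) ιs))
  φ-outnumberSum-≥ {p} {n} ιs 1≤p p≤3 p≤n n≤b =
    subst (λ b → φ c p n ≤ φ c p b) (sym (sum-outNumber c ιs))
      (φ-≤-outDigits (sum≤length (digits≤1 ιs)) 1≤p p≤3 (length≤sum (1≤outBlocks ιs))
        p≤n (subst (n ≤_) (sum-outNumber c ιs) n≤b))

  φ-partition-bounds : PartD c
  φ-partition-bounds p n a b O fl cl 1≤p p≤3 (O-positive , refl) floors ceilings (_ , refl) (_ , refl)
    with All-parametrised (proj₂ (inNumber-parametrises (1 + t))) (Pointwise⇒Allʳ proj₁ floors)
       | All-parametrised (proj₂ (outNumber-parametrises (1 + t))) (Pointwise⇒Allʳ proj₁ ceilings)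
  ... | ιs , refl | κs , refl =
    φ-adjFloorSum-≤ ιs p≤3 (sum-mono-≤ (proj₁ ∘ proj₂) (Pointwise.sym id floors)) ,
    φ-outnumberSum-≥ κs 1≤p p≤3 (length≤sum O-positive) (sum-mono-≤ (proj₁ ∘ proj₂) ceilings)

lemma5 : ∀ c → 3 ≤ c → PartA c × PartB c × PartC c × PartD c
lemma5 (suc (suc (suc t))) _ = φ-parity t , φ₁-bijections t , φ-additive t , φ-partition-bounds t
lemma5 (suc (suc zero)) (s≤s (s≤s ()))
lemma5 (suc zero) (s≤s ())
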